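{- Let $M=(E,\mathcal I)$ be a matroid with base family $\mathcal B$, and let $\widetilde{\mathcal B}$ be a Fulkerson dual family of $\mathcal B$. Let $\rho\in\mathbb R^E_{\ge 0}$, $\eta\in\mathbb R^E_{\ge0}$, and let $\mu$ be a probability mass function on $\mathcal B$. Then $\rho$, $\eta$ and $\mu$ are optimal, respectively, for $\mathrm{Mod}_2(\mathcal B)$, $\mathrm{Mod}_2(\widetilde{\mathcal B})$ and $\mathrm{MEO}(\mathcal B)$ if and only if the following three conditions hold: (i) $\rho\in\mathrm{Adm}(\mathcal B)$ and $\eta(e)=\sum_{B\in\mathcal B:\,e\in B}\mu(B)$ for all $e\in E$; (ii) there is a constant $c>0$ such that $\rho(e)=c\,\eta(e)$ for all $e\in E$; (iii) $\mu(B)\,(1-\ell_\rho(B))=0$ for all $B\in\mathcal B$, where $\ell_\rho(B)=\sum_{e\in B}\rho(e)$. Moreover, in this case the constant $c$ in (ii) equals $\mathrm{Mod}_2(\mathcal B)$ and $1/c=\mathrm{MEO}(\mathcal B)=\mathrm{Mod}_2(\widetilde{\mathcal B})$.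
   Context: A matroid $M=(E,\mathcal I)$ on a finite set $E$ has rank function $r$ and base family $\mathcal B$ (maximal independent sets, all of size $r(E)$). Standing assumption: all matroids are loopless (every singleton is independent) and have $r(E)>0$. Each base is identified with its indicator vector in $\mathbb R^E$. For a family $\Gamma$ of vectors in $\mathbb R^E_{\ge0}$, $\mathrm{Adm}(\Gamma)=\{\rho\in\mathbb R^E_{\ge0}:\sum_{e}\gamma(e)\rho(e)\ge 1\ \forall\gamma\in\Gamma\}$ and $\mathrm{Mod}_2(\Gamma)=\inf\{\sum_{e\in E}\rho(e)^2:\rho\in\mathrm{Adm}(\Gamma)\}$; a density is optimal if it attains this infimum. The blocker of $K\subseteq\mathbb R^E_{\ge0}$ is $\mathrm{BL}(K)=\{\eta\in\mathbb R^E_{\ge0}:\eta^T\rho\ge1\ \forall\rho\in K\}$. A set $\widetilde{\mathcal B}\subseteq\mathbb R^E_{\ge0}$ is a Fulkerson dual family of $\mathcal B$ if $\mathrm{Adm}(\widetilde{\mathcal B})=\mathrm{BL}(\mathrm{Adm}(\mathcal B))$. The minimum expected overlap is $\mathrm{MEO}(\mathcal B)=\min_{\mu}\sum_{B,B'\in\mathcal B}\mu(B)\mu(B')|B\cap B'|$, the minimum over probability mass functions $\mu$ on $\mathcal B$; $\mu$ is optimal if it attains the minimum. -}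

module Defs where

open import Data.Nat as ℕ using (ℕ; zero; suc)
open import Data.Bool using (Bool; true; false)
open import Data.Fin as F using (Fin)
open import Data.Fin.Subset using (Subset; _∈_; _∉_; _⊆_; _∪_; _∩_; ⁅_⁆; ∣_∣; ⊥)
open import Data.Vec using (Vec; []; _∷_; lookup)
open import Data.Product using (Σ; ∃; ∃-syntax; _×_; _,_)
open import Relation.Nullary using (¬_)
open import Relation.Binary.PropositionalEquality using (_≡_)
open import Algebra.Structures using (IsCommutativeRing)
open import Relation.Binary.Structures using (IsTotalOrder)

-- The real numbers, specified axiomatically as a complete ordered field
-- (unique up to isomorphism; the standard library has no reals).

record CompleteOrderedField : Set₁ where
  infixl 6 _+_
  infixl 7 _*_
  infix 4 _≤_
  field
    Carrier : Set
    0# 1#   : Carrier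
    _+_ _*_ : Carrier → Carrier → Carrier
    -_      : Carrier → Carrier
    _≤_     : Carrier → Carrier → Set
    isCommutativeRing : IsCommutativeRing _≡_ _+_ _*_ -_ 0# 1#
    0≢1       : ¬ (0# ≡ 1#)
    inverse   : ∀ x → ¬ (x ≡ 0#) → ∃[ y ] (x * y ≡ 1#)
    isTotalOrder : IsTotalOrder _≡_ _≤_
    +-mono-≤  : ∀ {x y} z → x ≤ y → x + z ≤ y + z
    *-nonneg  : ∀ {x y} → 0# ≤ x → 0# ≤ y → 0# ≤ x * y
    complete  : (P : Carrier → Set) → ∃ P → (∃[ b ] (∀ x → P x → x ≤ b)) →
                ∃[ s ] ((∀ x → P x → x ≤ s) × (∀ b → (∀ x → P x → x ≤ b) → s ≤ b))

  infix 4 _<_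
  _<_ : Carrier → Carrier → Set
  x < y = x ≤ y × ¬ (x ≡ y)

  _-_ : Carrier → Carrier → Carrier
  x - y = x + (- y)

  fromℕ : ℕ → Carrier
  fromℕ zero    = 0#
  fromℕ (suc k) = 1# + fromℕ k

record Matroid (n : ℕ) : Set₁ where
  field
    Indep      : Subset n → Set
    indep-∅    : Indep ⊥
    indep-⊆    : ∀ {I J} → J ⊆ I → Indep I → Indep J
    exchange   : ∀ {I J} → Indep I → Indep J → ∣ I ∣ ℕ.< ∣ J ∣ →
                 ∃[ e ] (e ∈ J × e ∉ I × Indep (I ∪ ⁅ e ⁆))

module _ {n : ℕ} (M : Matroid n) where
  open Matroid M

  Loopless : Set
  Loopless = ∀ (e : Fin n) → Indep ⁅ e ⁆

  IsBase : Subset n → Set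
  IsBase B = Indep B × (∀ J → Indep J → B ⊆ J → J ≡ B)

  PositiveRank : Set
  PositiveRank = ∃[ I ] (Indep I × 0 ℕ.< ∣ I ∣)

module Real (ℝ : CompleteOrderedField) where
  open CompleteOrderedField ℝ public

  sumE : ∀ {n} → (Fin n → Carrier) → Carrier
  sumE {zero}  f = 0#
  sumE {suc n} f = f F.zero + sumE (λ i → f (F.suc i))

  sumSub : ∀ {n} → (Subset n → Carrier) → Carrier
  sumSub {zero}  f = f []
  sumSub {suc n} f = sumSub (λ s → f (false ∷ s)) + sumSub (λ s → f (true ∷ s))

  ind : ∀ {n} → Subset n → Fin n → Carrier
  ind B e with lookup B e
  ... | true  = 1#
  ... | false = 0#

  Vector : ℕ → Set
  Vector n = Fin n → Carrier

  Family : ℕ → Set₁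
  Family n = Vector n → Set

  NonNeg : ∀ {n} → Vector n → Set
  NonNeg ρ = ∀ e → 0# ≤ ρ e

  dot : ∀ {n} → Vector n → Vector n → Carrier
  dot γ ρ = sumE (λ e → γ e * ρ e)

  energy : ∀ {n} → Vector n → Carrier
  energy ρ = sumE (λ e → ρ e * ρ e)

  ℓ : ∀ {n} → Vector n → Subset n → Carrier
  ℓ ρ B = dot (ind B) ρ

  Adm : ∀ {n} → Family n → Family n
  Adm Γ ρ = NonNeg ρ × (∀ γ → Γ γ → 1# ≤ dot γ ρ)

  BL : ∀ {n} → Family n → Family n
  BL K η = NonNeg η × (∀ ρ → K ρ → 1# ≤ dot η ρ)

  Mod2Optimal : ∀ {n} → Family n → Vector n → Set
  Mod2Optimal Γ ρ = Adm Γ ρ × (∀ ρ' → Adm Γ ρ' → energy ρ ≤ energy ρ')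

  IsMod2 : ∀ {n} → Family n → Carrier → Set
  IsMod2 Γ v = (∀ ρ → Adm Γ ρ → v ≤ energy ρ)
             × (∀ ε → 0# < ε → ∃[ ρ ] (Adm Γ ρ × energy ρ < v + ε))

  module _ {n : ℕ} (M : Matroid n) where

    BaseFamily : Family n
    BaseFamily γ = ∃[ B ] (IsBase M B × (∀ e → γ e ≡ ind B e))

    IsFulkersonDual : Family n → Set
    IsFulkersonDual Γ = (∀ γ → Γ γ → NonNeg γ)
                      × (∀ η → Adm Γ η → BL (Adm BaseFamily) η)
                      × (∀ η → BL (Adm BaseFamily) η → Adm Γ η)

    IsPMF : (Subset n → Carrier) → Set
    IsPMF μ = (∀ B → 0# ≤ μ B) × (∀ B → ¬ IsBase M B → μ B ≡ 0#)
            × sumSub μ ≡ 1#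

    expOverlap : (Subset n → Carrier) → Carrier
    expOverlap μ = sumSub (λ B → sumSub (λ B' → μ B * μ B' * fromℕ ∣ B ∩ B' ∣))

    MEOOptimal : (Subset n → Carrier) → Set
    MEOOptimal μ = IsPMF μ × (∀ μ' → IsPMF μ' → expOverlap μ ≤ expOverlap μ')

    IsMEO : Carrier → Set
    IsMEO v = (∃[ μ ] (IsPMF μ × expOverlap μ ≡ v)) × (∀ μ → IsPMF μ → v ≤ expOverlap μ)

    edgeUsage : (Subset n → Carrier) → Vector n
    edgeUsage μ e = sumSub (λ B → μ B * ind B e)

{-# OPTIONS --safe #-}
-- Write z(μ) for the edge usage of a distribution μ on the bases. The expected overlap of μ is the
-- energy |z(μ)|², and z(μ) lies in the blocker of Adm ℬ because every base has ρ-length at least 1.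
-- Hence if ρ ∈ Adm ℬ, η = z(μ), ρ = c η and ⟨η, ρ⟩ = 1 (which is complementary slackness (iii)),
-- Cauchy–Schwarz shows that ρ, η and μ attain Mod₂(ℬ) = c and Mod₂(ℬ̃) = MEO(ℬ) = 1/c.
-- Conversely, if μ is MEO-optimal, shifting mass from μ towards any base B cannot lower |z|², so
-- ⟨z, 1_B⟩ ≥ |z|² and z / |z|² is admissible; by the first part it is optimal together with z, and
-- since the energy is strictly convex the optimal ρ and η must be these two.
-- Constructively, completeness makes ≤ stable under double negation, which stands in for case
-- splits on the undecidable predicate "B is a base".
module Submission where

open import Defs
open import Algebra.Bundles using (CommutativeRing)
open import Algebra.Solver.Ring.AlmostCommutativeRing using (_-Raw-AlmostCommutative⟶_; fromCommutativeRing)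
open import Data.Bool using (true; false)
open import Data.Empty using (⊥-elim)
open import Data.Fin as F using (Fin)
open import Data.Fin.Subset using (Subset; _∩_; ∣_∣)
open import Data.Integer as ℤ using (ℤ; -[1+_])
import Data.Integer.Properties as ℤ
open import Data.Maybe as Maybe using ()
open import Data.Nat as ℕ using (ℕ; zero; suc)
import Data.Nat.Properties as ℕ
open import Data.Product using (_×_; _,_; proj₁; proj₂; ∃-syntax)
open import Data.Sign as Sign using (Sign)
open import Data.Sum using (_⊎_; inj₁; inj₂)
open import Data.Vec using ([]; _∷_; lookup)
open import Function using (_∘_)
open import Function.Bundles using (_⇔_; mk⇔)
open import Relation.Binary.PropositionalEquality
open import Relation.Binary.Structures using (IsTotalOrder)
open import Relation.Nullary using (¬_)
open import Relation.Nullary.Decidable using (dec⇒maybe)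

module _ (ℝ : CompleteOrderedField) where
  open Real ℝ
  open ≡-Reasoning

  -- Defs gives _-_ no fixity, so it binds tighter than _+_ and _*_: differences are parenthesised.

  commutativeRing : CommutativeRing _ _
  commutativeRing = record { isCommutativeRing = isCommutativeRing }

  open CommutativeRing commutativeRing
    using ( +-comm; +-identityˡ; +-identityʳ; -‿inverseʳ
          ; *-assoc; *-comm; *-identityˡ; *-identityʳ; zeroˡ; zeroʳ; distribˡ )
  open import Algebra.Properties.Ring (CommutativeRing.ring commutativeRing)
    using (-0#≈0#; -‿involutive; -‿+-comm; -‿distribʳ-*; -1*x≈-x; x[y-z]≈xy-xz)
  open import Algebra.Properties.CommutativeSemigroup (CommutativeRing.+-commutativeSemigroup commutativeRing)
    using () renaming (interchange to +-interchange)
  open import Algebra.Properties.CommutativeSemigroup (CommutativeRing.*-commutativeSemigroup commutativeRing)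
    using () renaming (interchange to *-interchange)
  open import Algebra.Properties.Semiring.Mult.TCOptimised (CommutativeRing.semiring commutativeRing)
    using (1+×; ×-homo-+; ×1-homo-*) renaming (_×_ to _×′_)
  open IsTotalOrder isTotalOrder
    using (antisym; total) renaming (refl to ≤-refl; trans to ≤-trans; reflexive to ≤-reflexive)

  -- The ring solver needs coefficients with decidable equality; ℤ maps into every commutative ring.

  ⟦_⟧ℤ : ℤ → Carrier
  ⟦ ℤ.+ n    ⟧ℤ = n ×′ 1#
  ⟦ -[1+ n ] ⟧ℤ = - (suc n ×′ 1#)

  ⊖-homo : ∀ m n → ⟦ m ℤ.⊖ n ⟧ℤ ≡ (m ×′ 1#) - (n ×′ 1#)
  ⊖-homo zero    zero    = sym (-‿inverseʳ 0#)
  ⊖-homo zero    (suc n) = sym (+-identityˡ _)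
  ⊖-homo (suc m) zero    = sym (trans (cong (suc m ×′ 1# +_) -0#≈0#) (+-identityʳ _))
  ⊖-homo (suc m) (suc n) = begin
    ⟦ suc m ℤ.⊖ suc n ⟧ℤ          ≡⟨ cong ⟦_⟧ℤ (ℤ.[1+m]⊖[1+n]≡m⊖n m n) ⟩
    ⟦ m ℤ.⊖ n ⟧ℤ                  ≡⟨ ⊖-homo m n ⟩
    a - b                         ≡⟨ +-identityˡ (a - b) ⟨
    0# + (a - b)                  ≡⟨ cong (_+ (a - b)) (-‿inverseʳ 1#) ⟨
    (1# - 1#) + (a + - b)         ≡⟨ +-interchange 1# (- 1#) a (- b) ⟩
    (1# + a) + (- 1# + - b)       ≡⟨ cong ((1# + a) +_) (-‿+-comm 1# b) ⟩
    (1# + a) - (1# + b)           ≡⟨ cong₂ _-_ (1+× m 1#) (1+× n 1#) ⟨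
    (suc m ×′ 1#) - (suc n ×′ 1#) ∎
    where
    a b : Carrier
    a = m ×′ 1#
    b = n ×′ 1#

  +-homo : ∀ i j → ⟦ i ℤ.+ j ⟧ℤ ≡ ⟦ i ⟧ℤ + ⟦ j ⟧ℤ
  +-homo (ℤ.+ m)  (ℤ.+ n)  = ×-homo-+ 1# m n
  +-homo (ℤ.+ m)  -[1+ n ] = ⊖-homo m (suc n)
  +-homo -[1+ m ] (ℤ.+ n)  = trans (⊖-homo n (suc m)) (+-comm _ _)
  +-homo -[1+ m ] -[1+ n ] = begin
    - (suc (suc (m ℕ.+ n)) ×′ 1#)       ≡⟨ cong (λ k → - (suc k ×′ 1#)) (ℕ.+-suc m n) ⟨
    - ((suc m ℕ.+ suc n) ×′ 1#)         ≡⟨ cong -_ (×-homo-+ 1# (suc m) (suc n)) ⟩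
    - (suc m ×′ 1# + suc n ×′ 1#)       ≡⟨ -‿+-comm _ _ ⟨
    - (suc m ×′ 1#) + - (suc n ×′ 1#)   ∎

  ⟦_⟧sign : Sign → Carrier
  ⟦ Sign.+ ⟧sign = 1#
  ⟦ Sign.- ⟧sign = - 1#

  sign-*-homo : ∀ s t → ⟦ s Sign.* t ⟧sign ≡ ⟦ s ⟧sign * ⟦ t ⟧sign
  sign-*-homo Sign.+ t      = sym (*-identityˡ _)
  sign-*-homo Sign.- Sign.+ = sym (*-identityʳ _)
  sign-*-homo Sign.- Sign.- = begin
    1#              ≡⟨ -‿involutive 1# ⟨
    - - 1#          ≡⟨ cong -_ (-1*x≈-x 1#) ⟨
    - (- 1# * 1#)   ≡⟨ -‿distribʳ-* (- 1#) 1# ⟩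
    - 1# * - 1#     ∎

  ◃-homo : ∀ s n → ⟦ s ℤ.◃ n ⟧ℤ ≡ ⟦ s ⟧sign * n ×′ 1#
  ◃-homo s      zero    = sym (zeroʳ _)
  ◃-homo Sign.+ (suc n) = sym (*-identityˡ _)
  ◃-homo Sign.- (suc n) = sym (-1*x≈-x _)

  sign-abs-homo : ∀ i → ⟦ i ⟧ℤ ≡ ⟦ ℤ.sign i ⟧sign * ℤ.∣ i ∣ ×′ 1#
  sign-abs-homo i = trans (cong ⟦_⟧ℤ (sym (ℤ.◃-inverse i))) (◃-homo (ℤ.sign i) ℤ.∣ i ∣)

  *-homo : ∀ i j → ⟦ i ℤ.* j ⟧ℤ ≡ ⟦ i ⟧ℤ * ⟦ j ⟧ℤ
  *-homo i j = begin
    ⟦ i ℤ.* j ⟧ℤ                                                  ≡⟨ ◃-homo (ℤ.sign i Sign.* ℤ.sign j) (ℤ.∣ i ∣ ℕ.* ℤ.∣ j ∣) ⟩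
    ⟦ ℤ.sign i Sign.* ℤ.sign j ⟧sign * (ℤ.∣ i ∣ ℕ.* ℤ.∣ j ∣) ×′ 1#  ≡⟨ cong₂ _*_ (sign-*-homo (ℤ.sign i) (ℤ.sign j)) (×1-homo-* ℤ.∣ i ∣ ℤ.∣ j ∣) ⟩
    (⟦ ℤ.sign i ⟧sign * ⟦ ℤ.sign j ⟧sign) * (ℤ.∣ i ∣ ×′ 1# * ℤ.∣ j ∣ ×′ 1#)
                                                                  ≡⟨ *-interchange _ _ _ _ ⟩
    (⟦ ℤ.sign i ⟧sign * ℤ.∣ i ∣ ×′ 1#) * (⟦ ℤ.sign j ⟧sign * ℤ.∣ j ∣ ×′ 1#)
                                                                  ≡⟨ cong₂ _*_ (sign-abs-homo i) (sign-abs-homo j) ⟨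
    ⟦ i ⟧ℤ * ⟦ j ⟧ℤ                                               ∎

  -‿homo : ∀ i → ⟦ ℤ.- i ⟧ℤ ≡ - ⟦ i ⟧ℤ
  -‿homo (ℤ.+ zero)  = sym -0#≈0#
  -‿homo (ℤ.+ suc n) = refl
  -‿homo -[1+ n ]    = sym (-‿involutive _)

  ℤ⟶ℝ : ℤ.+-*-rawRing -Raw-AlmostCommutative⟶ fromCommutativeRing commutativeRing
  ℤ⟶ℝ = record
    { ⟦_⟧ = ⟦_⟧ℤ ; +-homo = +-homo ; *-homo = *-homo ; -‿homo = -‿homo
    ; 0-homo = refl ; 1-homo = refl }

  open import Algebra.Solver.Ring ℤ.+-*-rawRing (fromCommutativeRing commutativeRing) ℤ⟶ℝ
    (λ i j → Maybe.map (cong ⟦_⟧ℤ) (dec⇒maybe (i ℤ.≟ j)))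
    using (solve; _:=_; _:+_; _:*_; :-_; _:-_; con)

  +-monoʳ-≤ : ∀ {x y} z → x ≤ y → z + x ≤ z + y
  +-monoʳ-≤ {x} {y} z x≤y = subst₂ _≤_ (+-comm x z) (+-comm y z) (+-mono-≤ z x≤y)

  +-mono₂-≤ : ∀ {a b c d} → a ≤ b → c ≤ d → a + c ≤ b + d
  +-mono₂-≤ {b = b} {c} a≤b c≤d = ≤-trans (+-mono-≤ c a≤b) (+-monoʳ-≤ b c≤d)

  +-cancelʳ-≤ : ∀ {a b} k → a + k ≤ b + k → a ≤ b
  +-cancelʳ-≤ {a} {b} k p = subst₂ _≤_ (x+k-k≡x a) (x+k-k≡x b) (+-mono-≤ (- k) p)
    where
    x+k-k≡x : ∀ x → (x + k) - k ≡ x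
    x+k-k≡x x = solve 2 (λ x k → (x :+ k) :- k := x) refl x k

  +-cancelˡ-≤ : ∀ {a b} k → k + a ≤ k + b → a ≤ b
  +-cancelˡ-≤ {a} {b} k p = +-cancelʳ-≤ k (subst₂ _≤_ (+-comm k a) (+-comm k b) p)

  0≤y-x⇒x≤y : ∀ {x y} → 0# ≤ y - x → x ≤ y
  0≤y-x⇒x≤y {x} {y} p = subst₂ _≤_ (+-identityˡ x) (y-x+x≡y x y) (+-mono-≤ x p)
    where
    y-x+x≡y : ∀ x y → (y - x) + x ≡ y
    y-x+x≡y = solve 2 (λ x y → (y :- x) :+ x := y) refl

  x≤y⇒0≤y-x : ∀ {x y} → x ≤ y → 0# ≤ y - x
  x≤y⇒0≤y-x {x} {y} p = subst (_≤ y - x) (-‿inverseʳ x) (+-mono-≤ (- x) p)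

  *-monoˡ-≤-nonNeg : ∀ {c x y} → 0# ≤ c → x ≤ y → c * x ≤ c * y
  *-monoˡ-≤-nonNeg {c} {x} {y} 0≤c x≤y =
    0≤y-x⇒x≤y (subst (0# ≤_) (c[y-x]≡cy-cx c x y) (*-nonneg 0≤c (x≤y⇒0≤y-x x≤y)))
    where
    c[y-x]≡cy-cx : ∀ c x y → c * (y - x) ≡ (c * y) - (c * x)
    c[y-x]≡cy-cx = solve 3 (λ c x y → c :* (y :- x) := c :* y :- c :* x) refl

  neg-antimono-≤ : ∀ {x y} → x ≤ y → - y ≤ - x
  neg-antimono-≤ {x} {y} p = 0≤y-x⇒x≤y (subst (0# ≤_) (y-x≡[-x]-[-y] x y) (x≤y⇒0≤y-x p))
    where
    y-x≡[-x]-[-y] : ∀ x y → y - x ≡ (- x) - (- y)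
    y-x≡[-x]-[-y] = solve 2 (λ x y → y :- x := (:- x) :- (:- y)) refl

  x≤0⇒0≤-x : ∀ {x} → x ≤ 0# → 0# ≤ - x
  x≤0⇒0≤-x p = subst (_≤ _) -0#≈0# (neg-antimono-≤ p)

  0≤-x⇒x≤0 : ∀ {x} → 0# ≤ - x → x ≤ 0#
  0≤-x⇒x≤0 {x} p = subst₂ _≤_ (-‿involutive x) -0#≈0# (neg-antimono-≤ p)

  0≤x*x : ∀ x → 0# ≤ x * x
  0≤x*x x with total 0# x
  ... | inj₁ 0≤x = *-nonneg 0≤x 0≤x
  ... | inj₂ x≤0 = subst (0# ≤_) -x*-x≡x*x (*-nonneg (x≤0⇒0≤-x x≤0) (x≤0⇒0≤-x x≤0))
    where
    -x*-x≡x*x : - x * - x ≡ x * x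
    -x*-x≡x*x = solve 1 (λ x → (:- x) :* (:- x) := x :* x) refl x

  0≤1 : 0# ≤ 1#
  0≤1 = subst (0# ≤_) (*-identityˡ 1#) (0≤x*x 1#)

  1≰0 : ¬ (1# ≤ 0#)
  1≰0 1≤0 = 0≢1 (antisym 0≤1 1≤0)

  +-nonNeg : ∀ {a b} → 0# ≤ a → 0# ≤ b → 0# ≤ a + b
  +-nonNeg 0≤a 0≤b = subst (_≤ _) (+-identityʳ 0#) (+-mono₂-≤ 0≤a 0≤b)

  nonNeg-+-zero : ∀ {a b} → 0# ≤ a → 0# ≤ b → a + b ≡ 0# → a ≡ 0# × b ≡ 0#
  nonNeg-+-zero {a} {b} 0≤a 0≤b a+b≡0 =
    antisym (subst₂ _≤_ (+-identityʳ a) a+b≡0 (+-monoʳ-≤ a 0≤b)) 0≤a ,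
    antisym (subst₂ _≤_ (+-identityˡ b) a+b≡0 (+-mono-≤ b 0≤a)) 0≤b

  inverse-nonNeg : ∀ {a b} → 0# ≤ a → a * b ≡ 1# → 0# ≤ b
  inverse-nonNeg {a} {b} 0≤a ab≡1 with total 0# b
  ... | inj₁ 0≤b = 0≤b
  ... | inj₂ b≤0 = ⊥-elim (1≰0 (0≤-x⇒x≤0 (subst (0# ≤_) a*-b≡-1 (*-nonneg 0≤a (x≤0⇒0≤-x b≤0)))))
    where
    a*-b≡-1 : a * - b ≡ - 1#
    a*-b≡-1 = trans (sym (-‿distribʳ-* a b)) (cong -_ ab≡1)

  two : Carrier
  two = 1# + 1#

  0≤two : 0# ≤ two
  0≤two = +-nonNeg 0≤1 0≤1

  two≢0 : ¬ (two ≡ 0#)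
  two≢0 two≡0 = 1≰0 (subst (1# ≤_) two≡0 (subst (_≤ two) (+-identityʳ 1#) (+-monoʳ-≤ 1# 0≤1)))

  half : Carrier
  half = proj₁ (inverse two two≢0)

  two*half≡1 : two * half ≡ 1#
  two*half≡1 = proj₂ (inverse two two≢0)

  0≤half : 0# ≤ half
  0≤half = inverse-nonNeg 0≤two two*half≡1

  two*[half*x]≡x : ∀ x → two * (half * x) ≡ x
  two*[half*x]≡x x = trans (sym (*-assoc two half x)) (trans (cong (_* x) two*half≡1) (*-identityˡ x))

  half*[x+x]≡x : ∀ x → half * (x + x) ≡ x
  half*[x+x]≡x x = trans (solve 2 (λ h x → h :* (x :+ x) := con (ℤ.+ 2) :* (h :* x)) refl half x) (two*[half*x]≡x x)

  -- The supremum s of {t ≥ 0 | ¬ ¬ (t ≤ 0)} also bounds 2t for each such t, so s ≤ s / 2.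
  nonPos-stable : ∀ {x} → 0# ≤ x → ¬ ¬ (x ≤ 0#) → x ≤ 0#
  nonPos-stable {x} 0≤x ¬¬x≤0 = ≤-trans (isUpperBound x (0≤x , ¬¬x≤0)) s≤0
    where
    P : Carrier → Set
    P t = 0# ≤ t × ¬ ¬ (t ≤ 0#)

    P⇒≤1 : ∀ t → P t → t ≤ 1#
    P⇒≤1 t (_ , ¬¬t≤0) with total t 1#
    ... | inj₁ t≤1 = t≤1
    ... | inj₂ 1≤t = ⊥-elim (¬¬t≤0 (λ t≤0 → 1≰0 (≤-trans 1≤t t≤0)))

    P-double : ∀ t → P t → P (t + t)
    P-double t (0≤t , ¬¬t≤0) = +-nonNeg 0≤t 0≤t ,
      λ ¬t+t≤0 → ¬¬t≤0 (λ t≤0 → ¬t+t≤0 (subst (_ ≤_) (+-identityʳ 0#) (+-mono₂-≤ t≤0 t≤0)))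

    sup : ∃[ s ] ((∀ t → P t → t ≤ s) × (∀ u → (∀ t → P t → t ≤ u) → s ≤ u))
    sup = complete P (x , 0≤x , ¬¬x≤0) (1# , P⇒≤1)
    s : Carrier
    s = proj₁ sup
    isUpperBound : ∀ t → P t → t ≤ s
    isUpperBound = proj₁ (proj₂ sup)
    isLeast : ∀ u → (∀ t → P t → t ≤ u) → s ≤ u
    isLeast = proj₂ (proj₂ sup)

    s≤half*s : s ≤ half * s
    s≤half*s = isLeast (half * s) λ t Pt →
      subst (_≤ half * s) (half*[x+x]≡x t) (*-monoˡ-≤-nonNeg 0≤half (isUpperBound (t + t) (P-double t Pt)))

    s≤0 : s ≤ 0#
    s≤0 = +-cancelˡ-≤ s (subst₂ _≤_ (solve 1 (λ s → con (ℤ.+ 2) :* s := s :+ s) refl s)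
                                    (trans (two*[half*x]≡x s) (sym (+-identityʳ s)))
                                    (*-monoˡ-≤-nonNeg 0≤two s≤half*s))

  ≤-stable : ∀ {x y} → ¬ ¬ (x ≤ y) → x ≤ y
  ≤-stable {x} {y} ¬¬x≤y with total x y
  ... | inj₁ x≤y = x≤y
  ... | inj₂ y≤x = 0≤y-x⇒x≤y (subst (0# ≤_) -[x-y]≡y-x (x≤0⇒0≤-x x-y≤0))
    where
    -[x-y]≡y-x : - (x - y) ≡ y - x
    -[x-y]≡y-x = solve 2 (λ x y → :- (x :- y) := y :- x) refl x y
    x-y≤0 : x - y ≤ 0#
    x-y≤0 = nonPos-stable (x≤y⇒0≤y-x y≤x)
      (λ ¬x-y≤0 → ¬¬x≤y (λ x≤y → ¬x-y≤0 (subst (x - y ≤_) (-‿inverseʳ y) (+-mono-≤ (- y) x≤y))))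

  ≡-stable : ∀ {x y} → ¬ ¬ (x ≡ y) → x ≡ y
  ≡-stable ¬¬x≡y = antisym (≤-stable (λ k → ¬¬x≡y (k ∘ ≤-reflexive)))
                           (≤-stable (λ k → ¬¬x≡y (k ∘ ≤-reflexive ∘ sym)))

  x*x≡0⇒x≡0 : ∀ {x} → x * x ≡ 0# → x ≡ 0#
  x*x≡0⇒x≡0 {x} x*x≡0 = ≡-stable λ x≢0 → let (y , x*y≡1) = inverse x x≢0 in x≢0 (begin
    x              ≡⟨ trans (cong (x *_) x*y≡1) (*-identityʳ x) ⟨
    x * (x * y)    ≡⟨ *-assoc x x y ⟨
    (x * x) * y    ≡⟨ cong (_* y) x*x≡0 ⟩
    0# * y         ≡⟨ zeroˡ y ⟩
    0#             ∎)

  excluded-middle : ∀ {P : Set} → ¬ ¬ (P ⊎ ¬ P)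
  excluded-middle k = k (inj₂ (k ∘ inj₁))

  sumE-cong : ∀ {n} {f g : Fin n → Carrier} → (∀ e → f e ≡ g e) → sumE f ≡ sumE g
  sumE-cong {zero}  f≗g = refl
  sumE-cong {suc n} f≗g = cong₂ _+_ (f≗g F.zero) (sumE-cong (f≗g ∘ F.suc))

  sumE-+ : ∀ {n} (f g : Fin n → Carrier) → sumE (λ e → f e + g e) ≡ sumE f + sumE g
  sumE-+ {zero}  f g = sym (+-identityʳ 0#)
  sumE-+ {suc n} f g = trans (cong (f F.zero + g F.zero +_) (sumE-+ (f ∘ F.suc) (g ∘ F.suc)))
                             (+-interchange _ _ _ _)

  sumE-* : ∀ {n} c (f : Fin n → Carrier) → sumE (λ e → c * f e) ≡ c * sumE f
  sumE-* {zero}  c f = sym (zeroʳ c)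
  sumE-* {suc n} c f = trans (cong (c * f F.zero +_) (sumE-* c (f ∘ F.suc))) (sym (distribˡ _ _ _))

  sumE-linear : ∀ {n} c d (f g : Fin n → Carrier) →
                sumE (λ e → c * f e + d * g e) ≡ c * sumE f + d * sumE g
  sumE-linear c d f g = trans (sumE-+ (λ e → c * f e) (λ e → d * g e)) (cong₂ _+_ (sumE-* c f) (sumE-* d g))

  sumE-− : ∀ {n} (f g : Fin n → Carrier) → sumE (λ e → f e - g e) ≡ sumE f - sumE g
  sumE-− f g = trans (sumE-+ f (λ e → - g e)) (cong (sumE f +_) (begin
    sumE (λ e → - g e)         ≡⟨ sumE-cong (λ e → -1*x≈-x (g e)) ⟨
    sumE (λ e → - 1# * g e)    ≡⟨ sumE-* (- 1#) g ⟩
    - 1# * sumE g              ≡⟨ -1*x≈-x (sumE g) ⟩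
    - sumE g                   ∎))

  sumE-0 : ∀ {n} → sumE {n} (λ _ → 0#) ≡ 0#
  sumE-0 {zero}  = refl
  sumE-0 {suc n} = trans (cong (0# +_) (sumE-0 {n})) (+-identityʳ 0#)

  sumE-mono-≤ : ∀ {n} {f g : Fin n → Carrier} → (∀ e → f e ≤ g e) → sumE f ≤ sumE g
  sumE-mono-≤ {zero}  f≤g = ≤-refl
  sumE-mono-≤ {suc n} f≤g = +-mono₂-≤ (f≤g F.zero) (sumE-mono-≤ (f≤g ∘ F.suc))

  sumE-nonNeg : ∀ {n} {f : Fin n → Carrier} → (∀ e → 0# ≤ f e) → 0# ≤ sumE f
  sumE-nonNeg {n} {f} 0≤f = subst (_≤ sumE f) (sumE-0 {n}) (sumE-mono-≤ 0≤f)

  sumE-nonNeg-zero : ∀ {n} {f : Fin n → Carrier} → (∀ e → 0# ≤ f e) → sumE f ≡ 0# → ∀ e → f e ≡ 0#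
  sumE-nonNeg-zero {suc n} 0≤f Σf≡0 F.zero    =
    proj₁ (nonNeg-+-zero (0≤f F.zero) (sumE-nonNeg (0≤f ∘ F.suc)) Σf≡0)
  sumE-nonNeg-zero {suc n} 0≤f Σf≡0 (F.suc e) = sumE-nonNeg-zero (0≤f ∘ F.suc)
    (proj₂ (nonNeg-+-zero (0≤f F.zero) (sumE-nonNeg (0≤f ∘ F.suc)) Σf≡0)) e

  sumSub-cong : ∀ {n} {f g : Subset n → Carrier} → (∀ B → f B ≡ g B) → sumSub f ≡ sumSub g
  sumSub-cong {zero}  f≗g = f≗g []
  sumSub-cong {suc n} f≗g = cong₂ _+_ (sumSub-cong (f≗g ∘ (false ∷_))) (sumSub-cong (f≗g ∘ (true ∷_)))

  sumSub-+ : ∀ {n} (f g : Subset n → Carrier) → sumSub (λ B → f B + g B) ≡ sumSub f + sumSub g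
  sumSub-+ {zero}  f g = refl
  sumSub-+ {suc n} f g = trans (cong₂ _+_ (sumSub-+ (f ∘ (false ∷_)) (g ∘ (false ∷_)))
                                          (sumSub-+ (f ∘ (true ∷_)) (g ∘ (true ∷_))))
                               (+-interchange _ _ _ _)

  sumSub-* : ∀ {n} c (f : Subset n → Carrier) → sumSub (λ B → c * f B) ≡ c * sumSub f
  sumSub-* {zero}  c f = refl
  sumSub-* {suc n} c f = trans (cong₂ _+_ (sumSub-* c (f ∘ (false ∷_))) (sumSub-* c (f ∘ (true ∷_))))
                               (sym (distribˡ _ _ _))

  sumSub-linear : ∀ {n} c d (f g : Subset n → Carrier) →
                  sumSub (λ B → c * f B + d * g B) ≡ c * sumSub f + d * sumSub g
  sumSub-linear c d f g = trans (sumSub-+ (λ B → c * f B) (λ B → d * g B)) (cong₂ _+_ (sumSub-* c f) (sumSub-* d g))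

  sumSub-− : ∀ {n} (f g : Subset n → Carrier) → sumSub (λ B → f B - g B) ≡ sumSub f - sumSub g
  sumSub-− f g = trans (sumSub-+ f (λ B → - g B)) (cong (sumSub f +_) (begin
    sumSub (λ B → - g B)       ≡⟨ sumSub-cong (λ B → -1*x≈-x (g B)) ⟨
    sumSub (λ B → - 1# * g B)  ≡⟨ sumSub-* (- 1#) g ⟩
    - 1# * sumSub g            ≡⟨ -1*x≈-x (sumSub g) ⟩
    - sumSub g                 ∎))

  sumSub-0 : ∀ {n} → sumSub {n} (λ _ → 0#) ≡ 0#
  sumSub-0 {zero}  = refl
  sumSub-0 {suc n} = trans (cong₂ _+_ (sumSub-0 {n}) (sumSub-0 {n})) (+-identityʳ 0#)

  sumSub-mono-≤ : ∀ {n} {f g : Subset n → Carrier} → (∀ B → f B ≤ g B) → sumSub f ≤ sumSub g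
  sumSub-mono-≤ {zero}  f≤g = f≤g []
  sumSub-mono-≤ {suc n} f≤g = +-mono₂-≤ (sumSub-mono-≤ (f≤g ∘ (false ∷_))) (sumSub-mono-≤ (f≤g ∘ (true ∷_)))

  sumSub-nonNeg : ∀ {n} {f : Subset n → Carrier} → (∀ B → 0# ≤ f B) → 0# ≤ sumSub f
  sumSub-nonNeg {n} {f} 0≤f = subst (_≤ sumSub f) (sumSub-0 {n}) (sumSub-mono-≤ 0≤f)

  sumSub-nonNeg-zero : ∀ {n} {f : Subset n → Carrier} → (∀ B → 0# ≤ f B) → sumSub f ≡ 0# → ∀ B → f B ≡ 0#
  sumSub-nonNeg-zero {zero}  0≤f Σf≡0 [] = Σf≡0
  sumSub-nonNeg-zero {suc n} {f} 0≤f Σf≡0 (b ∷ B) = sumSub-nonNeg-zero (0≤f ∘ (b ∷_)) (half-zero b) B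
    where
    halves-zero : sumSub (f ∘ (false ∷_)) ≡ 0# × sumSub (f ∘ (true ∷_)) ≡ 0#
    halves-zero = nonNeg-+-zero (sumSub-nonNeg (0≤f ∘ (false ∷_))) (sumSub-nonNeg (0≤f ∘ (true ∷_))) Σf≡0
    half-zero : ∀ b → sumSub (f ∘ (b ∷_)) ≡ 0#
    half-zero false = proj₁ halves-zero
    half-zero true  = proj₂ halves-zero

  sumE-sumSub-comm : ∀ {m n} (h : Fin m → Subset n → Carrier) →
                     sumE (λ e → sumSub (h e)) ≡ sumSub (λ B → sumE (λ e → h e B))
  sumE-sumSub-comm {zero}  {n} h = sym (sumSub-0 {n})
  sumE-sumSub-comm {suc m}     h = trans (cong (sumSub (h F.zero) +_) (sumE-sumSub-comm (h ∘ F.suc)))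
                                         (sym (sumSub-+ (h F.zero) _))

  dot-comm : ∀ {n} (a b : Vector n) → dot a b ≡ dot b a
  dot-comm a b = sumE-cong (λ e → *-comm (a e) (b e))

  dot-congˡ : ∀ {n} {a a' : Vector n} b → (∀ e → a e ≡ a' e) → dot a b ≡ dot a' b
  dot-congˡ b a≗a' = sumE-cong (λ e → cong (_* b e) (a≗a' e))

  dot-congʳ : ∀ {n} a {b b' : Vector n} → (∀ e → b e ≡ b' e) → dot a b ≡ dot a b'
  dot-congʳ a b≗b' = sumE-cong (λ e → cong (a e *_) (b≗b' e))

  dot-scaleˡ : ∀ {n} c (a b : Vector n) → dot (λ e → c * a e) b ≡ c * dot a b
  dot-scaleˡ c a b = trans (sumE-cong (λ e → *-assoc c (a e) (b e))) (sumE-* c (λ e → a e * b e))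

  dot-scaleʳ : ∀ {n} c (a b : Vector n) → dot a (λ e → c * b e) ≡ c * dot a b
  dot-scaleʳ c a b = trans (dot-comm a _) (trans (dot-scaleˡ c b a) (cong (c *_) (dot-comm b a)))

  energy-nonNeg : ∀ {n} (a : Vector n) → 0# ≤ energy a
  energy-nonNeg a = sumE-nonNeg (λ e → 0≤x*x (a e))

  energy-zero : ∀ {n} (a : Vector n) → energy a ≡ 0# → ∀ e → a e ≡ 0#
  energy-zero a Ea≡0 e = x*x≡0⇒x≡0 (sumE-nonNeg-zero (λ e → 0≤x*x (a e)) Ea≡0 e)

  energy-cong : ∀ {n} {a b : Vector n} → (∀ e → a e ≡ b e) → energy a ≡ energy b
  energy-cong {a = a} {b} a≗b = trans (dot-congˡ a a≗b) (dot-congʳ b a≗b)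

  two*dot≤energy+energy : ∀ {n} (a x : Vector n) → two * dot a x ≤ energy x + energy a
  two*dot≤energy+energy a x = subst₂ _≤_ (sumE-* two (λ e → a e * x e)) (sumE-+ (λ e → x e * x e) (λ e → a e * a e))
    (sumE-mono-≤ pointwise)
    where
    x²+a²≡2ax+[x-a]² : ∀ x a → x * x + a * a ≡ two * (a * x) + (x - a) * (x - a)
    x²+a²≡2ax+[x-a]² = solve 2 (λ x a → x :* x :+ a :* a := con (ℤ.+ 2) :* (a :* x) :+ (x :- a) :* (x :- a)) refl
    pointwise : ∀ e → two * (a e * x e) ≤ x e * x e + a e * a e
    pointwise e = subst₂ _≤_ (+-identityʳ _) (sym (x²+a²≡2ax+[x-a]² (x e) (a e)))
                            (+-monoʳ-≤ _ (0≤x*x (x e - a e)))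

  energy-lowerBound : ∀ {n} (a x : Vector n) {k} → energy a ≡ k → k ≤ dot a x → k ≤ energy x
  energy-lowerBound a x {k} Ea≡k k≤a·x = +-cancelʳ-≤ k (subst₂ _≤_
    (solve 1 (λ k → con (ℤ.+ 2) :* k := k :+ k) refl k) (cong (energy x +_) Ea≡k)
    (≤-trans (*-monoˡ-≤-nonNeg 0≤two k≤a·x) (two*dot≤energy+energy a x)))

  energy-certificate : ∀ {n} {K : Family n} {x y : Vector n} {c} → 0# ≤ c →
                       (∀ e → x e ≡ c * y e) → dot y x ≡ 1# → (∀ x' → K x' → 1# ≤ dot y x') →
                       energy x ≡ c × (∀ x' → K x' → c ≤ energy x')
  energy-certificate {x = x} {y} {c} 0≤c x≡cy y·x≡1 y-bounds = Ex≡c , lowerBound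
    where
    x·≡c*y· : ∀ x' → dot x x' ≡ c * dot y x'
    x·≡c*y· x' = trans (dot-congˡ x' x≡cy) (dot-scaleˡ c y x')
    Ex≡c : energy x ≡ c
    Ex≡c = trans (x·≡c*y· x) (trans (cong (c *_) y·x≡1) (*-identityʳ c))
    lowerBound : ∀ x' → _ → c ≤ energy x'
    lowerBound x' Kx' = energy-lowerBound x x' Ex≡c
      (subst₂ _≤_ (*-identityʳ c) (sym (x·≡c*y· x')) (*-monoˡ-≤-nonNeg 0≤c (y-bounds x' Kx')))

  Mod2Optimal⇒IsMod2 : ∀ {n} {Γ : Family n} {x v} → Mod2Optimal Γ x → energy x ≡ v → IsMod2 Γ v
  Mod2Optimal⇒IsMod2 {x = x} {v} (x-adm , x-min) Ex≡v =
    (λ x' x'-adm → subst (_≤ energy x') Ex≡v (x-min x' x'-adm)) ,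
    λ ε (0≤ε , 0≢ε) → x , x-adm , Ex<v+ε 0≤ε 0≢ε
    where
    Ex<v+ε : ∀ {ε} → 0# ≤ ε → ¬ (0# ≡ ε) → energy x < v + ε
    Ex<v+ε {ε} 0≤ε 0≢ε =
      subst (_≤ v + ε) (trans (+-identityʳ v) (sym Ex≡v)) (+-monoʳ-≤ v 0≤ε) ,
      λ Ex≡v+ε → 0≢ε (begin
        0#             ≡⟨ -‿inverseʳ v ⟨
        v - v          ≡⟨ cong (_- v) (trans (sym Ex≡v) Ex≡v+ε) ⟩
        (v + ε) - v    ≡⟨ solve 2 (λ v ε → (v :+ ε) :- v := ε) refl v ε ⟩
        ε              ∎)

  midpoint : ∀ {n} → Vector n → Vector n → Vector n
  midpoint a b e = half * (a e + b e)

  Adm-midpoint : ∀ {n} (Γ : Family n) {a b} → Adm Γ a → Adm Γ b → Adm Γ (midpoint a b)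
  Adm-midpoint Γ {a} {b} (0≤a , a-adm) (0≤b , b-adm) =
    (λ e → *-nonneg 0≤half (+-nonNeg (0≤a e) (0≤b e))) ,
    λ γ Γγ → subst (1# ≤_) (sym (γ·midpoint γ)) (1≤half*[x+y] (a-adm γ Γγ) (b-adm γ Γγ))
    where
    γ·midpoint : ∀ γ → dot γ (midpoint a b) ≡ half * (dot γ a + dot γ b)
    γ·midpoint γ = trans (sumE-cong (λ e → solve 4 (λ g h a b → g :* (h :* (a :+ b)) := h :* (g :* a :+ g :* b))
                                                    refl (γ e) half (a e) (b e)))
                         (trans (sumE-* half (λ e → γ e * a e + γ e * b e)) (cong (half *_) (sumE-+ (λ e → γ e * a e) (λ e → γ e * b e))))
    1≤half*[x+y] : ∀ {x y} → 1# ≤ x → 1# ≤ y → 1# ≤ half * (x + y)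
    1≤half*[x+y] {x} {y} 1≤x 1≤y = subst (_≤ half * (x + y)) (trans (*-comm half two) two*half≡1)
                                  (*-monoˡ-≤-nonNeg 0≤half (+-mono₂-≤ 1≤x 1≤y))

  parallelogram : ∀ {n} (a b : Vector n) →
                  energy (λ e → a e - b e) + (two * two) * energy (midpoint a b) ≡ two * energy a + two * energy b
  parallelogram {n} a b = begin
    energy d + (two * two) * energy m                       ≡⟨ cong (energy d +_) (sumE-* (two * two) (λ e → m e * m e)) ⟨
    energy d + sumE (λ e → (two * two) * (m e * m e))        ≡⟨ sumE-+ (λ e → d e * d e) _ ⟨
    sumE (λ e → d e * d e + (two * two) * (m e * m e))      ≡⟨ sumE-cong pointwise ⟩
    sumE (λ e → two * (a e * a e) + two * (b e * b e))      ≡⟨ sumE-linear two two (λ e → a e * a e) (λ e → b e * b e) ⟩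
    two * energy a + two * energy b                         ∎
    where
    d m : Vector n
    d e = a e - b e
    m = midpoint a b
    pointwise : ∀ e → d e * d e + (two * two) * (m e * m e) ≡ two * (a e * a e) + two * (b e * b e)
    pointwise e = begin
      d e * d e + (two * two) * (m e * m e)          ≡⟨ solve 2 (λ d m → d :* d :+ con (ℤ.+ 2) :* con (ℤ.+ 2) :* (m :* m)
                                                                   := d :* d :+ (con (ℤ.+ 2) :* m) :* (con (ℤ.+ 2) :* m)) refl (d e) (m e) ⟩
      d e * d e + (two * m e) * (two * m e)          ≡⟨ cong (λ s → d e * d e + s * s) (two*[half*x]≡x (a e + b e)) ⟩
      d e * d e + (a e + b e) * (a e + b e)          ≡⟨ solve 2 (λ a b → (a :- b) :* (a :- b) :+ (a :+ b) :* (a :+ b)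
                                                                   := con (ℤ.+ 2) :* (a :* a) :+ con (ℤ.+ 2) :* (b :* b)) refl (a e) (b e) ⟩
      two * (a e * a e) + two * (b e * b e)          ∎

  Mod2Optimal-unique : ∀ {n} (Γ : Family n) {a b} → Mod2Optimal Γ a → Mod2Optimal Γ b → ∀ e → a e ≡ b e
  Mod2Optimal-unique {n} Γ {a} {b} (a-adm , a-min) (b-adm , b-min) e = begin
    a e                  ≡⟨ solve 2 (λ a b → (a :- b) :+ b := a) refl (a e) (b e) ⟨
    (a e - b e) + b e    ≡⟨ cong (_+ b e) (energy-zero d Ed≡0 e) ⟩
    0# + b e             ≡⟨ +-identityˡ (b e) ⟩
    b e                  ∎
    where
    d : Vector n
    d e = a e - b e
    m : Vector n
    m = midpoint a b
    m-adm : Adm Γ m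
    m-adm = Adm-midpoint Γ a-adm b-adm
    Ed+4Em≤0+4Em : energy d + (two * two) * energy m ≤ 0# + (two * two) * energy m
    Ed+4Em≤0+4Em = subst₂ _≤_ (sym (parallelogram a b))
      (solve 1 (λ m → con (ℤ.+ 2) :* m :+ con (ℤ.+ 2) :* m := con (ℤ.+ 0) :+ con (ℤ.+ 2) :* con (ℤ.+ 2) :* m) refl (energy m))
      (+-mono₂-≤ (*-monoˡ-≤-nonNeg 0≤two (a-min m m-adm)) (*-monoˡ-≤-nonNeg 0≤two (b-min m m-adm)))
    Ed≡0 : energy d ≡ 0#
    Ed≡0 = antisym (+-cancelʳ-≤ _ Ed+4Em≤0+4Em) (energy-nonNeg d)

  -- The witness is t = x / s with s = b + 1 + x.
  bounded-ratio : ∀ {x b} → 0# ≤ x → 0# ≤ b →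
                  ∃[ s ] ∃[ t ] (0# ≤ s × s * t ≡ x × 0# ≤ t × t ≤ 1# × t * b ≤ x)
  bounded-ratio {x} {b} 0≤x 0≤b = s , t , 0≤s , s*t≡x , 0≤t , t≤1 , t*b≤x
    where
    s : Carrier
    s = (b + 1#) + x
    b≤s : b ≤ s
    b≤s = subst (_≤ s) (solve 1 (λ b → (b :+ con (ℤ.+ 0)) :+ con (ℤ.+ 0) := b) refl b)
                (+-mono₂-≤ (+-monoʳ-≤ b 0≤1) 0≤x)
    1≤s : 1# ≤ s
    1≤s = subst (_≤ s) (solve 0 ((con (ℤ.+ 0) :+ con (ℤ.+ 1)) :+ con (ℤ.+ 0) := con (ℤ.+ 1)) refl)
                (+-mono₂-≤ (+-mono-≤ 1# 0≤b) 0≤x)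
    0≤s : 0# ≤ s
    0≤s = ≤-trans 0≤1 1≤s
    s≢0 : ¬ (s ≡ 0#)
    s≢0 s≡0 = 1≰0 (subst (1# ≤_) s≡0 1≤s)
    s⁻¹ : Carrier
    s⁻¹ = proj₁ (inverse s s≢0)
    s*s⁻¹≡1 : s * s⁻¹ ≡ 1#
    s*s⁻¹≡1 = proj₂ (inverse s s≢0)
    0≤s⁻¹ : 0# ≤ s⁻¹
    0≤s⁻¹ = inverse-nonNeg 0≤s s*s⁻¹≡1
    t : Carrier
    t = x * s⁻¹
    0≤t : 0# ≤ t
    0≤t = *-nonneg 0≤x 0≤s⁻¹
    t≤1 : t ≤ 1#
    t≤1 = 0≤y-x⇒x≤y (subst (0# ≤_) [b+1]s⁻¹≡1-t (*-nonneg (+-nonNeg 0≤b 0≤1) 0≤s⁻¹))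
      where
      [b+1]s⁻¹≡1-t : (b + 1#) * s⁻¹ ≡ 1# - t
      [b+1]s⁻¹≡1-t = begin
        (b + 1#) * s⁻¹   ≡⟨ solve 3 (λ b x r → (b :+ con (ℤ.+ 1)) :* r := ((b :+ con (ℤ.+ 1)) :+ x) :* r :- x :* r) refl b x s⁻¹ ⟩
        (s * s⁻¹) - t    ≡⟨ cong (_- t) s*s⁻¹≡1 ⟩
        1# - t           ∎
    s*t≡x : s * t ≡ x
    s*t≡x = begin
      s * (x * s⁻¹)   ≡⟨ solve 3 (λ s x r → s :* (x :* r) := x :* (s :* r)) refl s x s⁻¹ ⟩
      x * (s * s⁻¹)   ≡⟨ cong (x *_) s*s⁻¹≡1 ⟩
      x * 1#          ≡⟨ *-identityʳ x ⟩
      x               ∎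
    t*b≤x : t * b ≤ x
    t*b≤x = subst₂ _≤_ (sym (*-assoc x s⁻¹ b)) (*-identityʳ x)
      (*-monoˡ-≤-nonNeg 0≤x (subst (s⁻¹ * b ≤_) (trans (*-comm s⁻¹ s) s*s⁻¹≡1) (*-monoˡ-≤-nonNeg 0≤s⁻¹ b≤s)))

  -- If a ≤ 0, testing at t ∈ [0, 1] with s t = -a and t b ≤ -a gives 0 ≤ -a², hence a = 0.
  quadratic-slope-nonNeg : ∀ {a b} → 0# ≤ b →
                           (∀ t → 0# ≤ t → t ≤ 1# → 0# ≤ (t + t) * a + (t * t) * b) → 0# ≤ a
  quadratic-slope-nonNeg {a} {b} 0≤b q≥0 with total 0# a
  ... | inj₁ 0≤a = 0≤a
  ... | inj₂ a≤0 = ≤-reflexive (sym (x*x≡0⇒x≡0 (antisym (0≤-x⇒x≤0 (0≤-a² (bounded-ratio 0≤-a 0≤b))) (0≤x*x a))))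
    where
    0≤-a : 0# ≤ - a
    0≤-a = x≤0⇒0≤-x a≤0
    0≤-a² : ∃[ s ] ∃[ t ] (0# ≤ s × s * t ≡ - a × 0# ≤ t × t ≤ 1# × t * b ≤ - a) → 0# ≤ - (a * a)
    0≤-a² (s , t , 0≤s , s*t≡-a , 0≤t , t≤1 , t*b≤-a) =
      subst (0# ≤_) (solve 1 (λ a → (:- a) :* ((a :+ a) :+ (:- a)) := :- (a :* a)) refl a)
        (≤-trans (subst (0# ≤_) s*q[t]≡-a*[2a+tb] (*-nonneg 0≤s (q≥0 t 0≤t t≤1)))
                 (*-monoˡ-≤-nonNeg 0≤-a (+-monoʳ-≤ (a + a) t*b≤-a)))
      where
      s*q[t]≡-a*[2a+tb] : s * ((t + t) * a + (t * t) * b) ≡ (- a) * ((a + a) + t * b)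
      s*q[t]≡-a*[2a+tb] = begin
        s * ((t + t) * a + (t * t) * b)   ≡⟨ solve 4 (λ s t a b → s :* ((t :+ t) :* a :+ (t :* t) :* b)
                                                                := (s :* t) :* ((a :+ a) :+ t :* b)) refl s t a b ⟩
        (s * t) * ((a + a) + t * b)       ≡⟨ cong (_* ((a + a) + t * b)) s*t≡-a ⟩
        (- a) * ((a + a) + t * b)         ∎

  energy-first-order : ∀ {n} (z w : Vector n) →
    (∀ t → 0# ≤ t → t ≤ 1# → energy z ≤ energy (λ e → (1# - t) * z e + t * w e)) →
    energy z ≤ dot z w
  energy-first-order {n} z w z-min =
    0≤y-x⇒x≤y (subst (0# ≤_) z·d≡z·w-Ez (quadratic-slope-nonNeg (energy-nonNeg d) slope≥0))
    where
    d : Vector n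
    d e = w e - z e

    z·d≡z·w-Ez : dot z d ≡ dot z w - energy z
    z·d≡z·w-Ez = trans (sumE-cong (λ e → x[y-z]≈xy-xz (z e) (w e) (z e))) (sumE-− (λ e → z e * w e) (λ e → z e * z e))

    expansion : ∀ t → energy (λ e → (1# - t) * z e + t * w e)
                      ≡ energy z + ((t + t) * dot z d + (t * t) * energy d)
    expansion t = begin
      sumE (λ e → ((1# - t) * z e + t * w e) * ((1# - t) * z e + t * w e))
        ≡⟨ sumE-cong (λ e → solve 3 (λ t z w → ((con (ℤ.+ 1) :- t) :* z :+ t :* w) :* ((con (ℤ.+ 1) :- t) :* z :+ t :* w)
                                      := z :* z :+ ((t :+ t) :* (z :* (w :- z)) :+ (t :* t) :* ((w :- z) :* (w :- z))))
                                      refl t (z e) (w e)) ⟩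
      sumE (λ e → z e * z e + ((t + t) * (z e * d e) + (t * t) * (d e * d e)))
        ≡⟨ sumE-+ (λ e → z e * z e) _ ⟩
      energy z + sumE (λ e → (t + t) * (z e * d e) + (t * t) * (d e * d e))
        ≡⟨ cong (energy z +_) (sumE-linear (t + t) (t * t) (λ e → z e * d e) (λ e → d e * d e)) ⟩
      energy z + ((t + t) * dot z d + (t * t) * energy d)
        ∎

    slope≥0 : ∀ t → 0# ≤ t → t ≤ 1# → 0# ≤ (t + t) * dot z d + (t * t) * energy d
    slope≥0 t 0≤t t≤1 = +-cancelˡ-≤ (energy z) (subst₂ _≤_ (sym (+-identityʳ _)) (expansion t) (z-min t 0≤t t≤1))

  ind-nonNeg : ∀ {n} (B : Subset n) e → 0# ≤ ind B e
  ind-nonNeg B e with lookup B e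
  ... | true  = 0≤1
  ... | false = ≤-refl

  ∣∩∣≡dot-ind : ∀ {n} (B B' : Subset n) → fromℕ ∣ B ∩ B' ∣ ≡ dot (ind B) (ind B')
  ∣∩∣≡dot-ind []          []           = refl
  ∣∩∣≡dot-ind (true ∷ B)  (true ∷ B')  = cong₂ _+_ (sym (*-identityˡ 1#)) (∣∩∣≡dot-ind B B')
  ∣∩∣≡dot-ind (true ∷ B)  (false ∷ B') = trans (sym (+-identityˡ _)) (cong₂ _+_ (sym (zeroʳ 1#)) (∣∩∣≡dot-ind B B'))
  ∣∩∣≡dot-ind (false ∷ B) (b ∷ B')     = trans (sym (+-identityˡ _)) (cong₂ _+_ (sym (zeroˡ _)) (∣∩∣≡dot-ind B B'))

  pointMass : ∀ {n} → Subset n → Subset n → Carrier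
  pointMass []          []          = 1#
  pointMass (false ∷ x) (false ∷ y) = pointMass x y
  pointMass (true ∷ x)  (true ∷ y)  = pointMass x y
  pointMass (false ∷ x) (true ∷ y)  = 0#
  pointMass (true ∷ x)  (false ∷ y) = 0#

  pointMass-nonNeg : ∀ {n} (x y : Subset n) → 0# ≤ pointMass x y
  pointMass-nonNeg []          []          = 0≤1
  pointMass-nonNeg (false ∷ x) (false ∷ y) = pointMass-nonNeg x y
  pointMass-nonNeg (true ∷ x)  (true ∷ y)  = pointMass-nonNeg x y
  pointMass-nonNeg (false ∷ x) (true ∷ y)  = ≤-refl
  pointMass-nonNeg (true ∷ x)  (false ∷ y) = ≤-refl

  pointMass-≢ : ∀ {n} {x y : Subset n} → x ≢ y → pointMass x y ≡ 0#
  pointMass-≢ {x = []}        {[]}        x≢y = ⊥-elim (x≢y refl)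
  pointMass-≢ {x = false ∷ x} {false ∷ y} x≢y = pointMass-≢ (x≢y ∘ cong (false ∷_))
  pointMass-≢ {x = true ∷ x}  {true ∷ y}  x≢y = pointMass-≢ (x≢y ∘ cong (true ∷_))
  pointMass-≢ {x = false ∷ x} {true ∷ y}  x≢y = refl
  pointMass-≢ {x = true ∷ x}  {false ∷ y} x≢y = refl

  sumSub-pointMass : ∀ {n} (x : Subset n) (f : Subset n → Carrier) → sumSub (λ B → pointMass x B * f B) ≡ f x
  sumSub-pointMass []          f = *-identityˡ (f [])
  sumSub-pointMass (false ∷ x) f =
    trans (cong₂ _+_ (sumSub-pointMass x (f ∘ (false ∷_))) (trans (sumSub-* 0# (f ∘ (true ∷_))) (zeroˡ _)))
          (+-identityʳ _)
  sumSub-pointMass (true ∷ x)  f =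
    trans (cong₂ _+_ (trans (sumSub-* 0# (f ∘ (false ∷_))) (zeroˡ _)) (sumSub-pointMass x (f ∘ (true ∷_))))
          (+-identityˡ _)

  mix : ∀ {n} → Carrier → (Subset n → Carrier) → (Subset n → Carrier) → Subset n → Carrier
  mix t μ ν B = (1# - t) * μ B + t * ν B

  module _ {n : ℕ} (M : Matroid n) where

    pointMass-IsPMF : ∀ {B₀} → IsBase M B₀ → IsPMF M (pointMass B₀)
    pointMass-IsPMF {B₀} B₀-base =
      pointMass-nonNeg B₀ ,
      (λ B ¬base → pointMass-≢ (λ B₀≡B → ¬base (subst (IsBase M) B₀≡B B₀-base))) ,
      trans (sumSub-cong {f = pointMass B₀} (λ B → sym (*-identityʳ _))) (sumSub-pointMass B₀ (λ _ → 1#))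

    edgeUsage-pointMass : ∀ B₀ e → edgeUsage M (pointMass B₀) e ≡ ind B₀ e
    edgeUsage-pointMass B₀ e = sumSub-pointMass B₀ (λ B → ind B e)

    mix-IsPMF : ∀ {t μ ν} → 0# ≤ t → t ≤ 1# → IsPMF M μ → IsPMF M ν → IsPMF M (mix t μ ν)
    mix-IsPMF {t} {μ} {ν} 0≤t t≤1 (0≤μ , μ-off , Σμ≡1) (0≤ν , ν-off , Σν≡1) =
      (λ B → +-nonNeg (*-nonneg (x≤y⇒0≤y-x t≤1) (0≤μ B)) (*-nonneg 0≤t (0≤ν B))) ,
      (λ B ¬base → begin
        (1# - t) * μ B + t * ν B   ≡⟨ cong₂ (λ a b → (1# - t) * a + t * b) (μ-off B ¬base) (ν-off B ¬base) ⟩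
        (1# - t) * 0# + t * 0#     ≡⟨ solve 1 (λ t → (con (ℤ.+ 1) :- t) :* con (ℤ.+ 0) :+ t :* con (ℤ.+ 0) := con (ℤ.+ 0)) refl t ⟩
        0#                         ∎) ,
      (begin
        sumSub (mix t μ ν)               ≡⟨ sumSub-linear (1# - t) t μ ν ⟩
        (1# - t) * sumSub μ + t * sumSub ν ≡⟨ cong₂ (λ a b → (1# - t) * a + t * b) Σμ≡1 Σν≡1 ⟩
        (1# - t) * 1# + t * 1#           ≡⟨ solve 1 (λ t → (con (ℤ.+ 1) :- t) :* con (ℤ.+ 1) :+ t :* con (ℤ.+ 1) := con (ℤ.+ 1)) refl t ⟩
        1#                               ∎)

    edgeUsage-mix : ∀ t μ ν e → edgeUsage M (mix t μ ν) e ≡ (1# - t) * edgeUsage M μ e + t * edgeUsage M ν e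
    edgeUsage-mix t μ ν e = trans
      (sumSub-cong (λ B → solve 5 (λ s m t v i → (s :* m :+ t :* v) :* i := s :* (m :* i) :+ t :* (v :* i))
                                   refl (1# - t) (μ B) t (ν B) (ind B e)))
      (sumSub-linear (1# - t) t (λ B → μ B * ind B e) (λ B → ν B * ind B e))

    dot-edgeUsage : ∀ μ x → dot (edgeUsage M μ) x ≡ sumSub (λ B → μ B * ℓ x B)
    dot-edgeUsage μ x = begin
      sumE (λ e → sumSub (λ B → μ B * ind B e) * x e)   ≡⟨ sumE-cong (λ e → trans (*-comm _ (x e)) (sym (sumSub-* (x e) (λ B → μ B * ind B e)))) ⟩
      sumE (λ e → sumSub (λ B → x e * (μ B * ind B e)))  ≡⟨ sumE-sumSub-comm (λ e B → x e * (μ B * ind B e)) ⟩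
      sumSub (λ B → sumE (λ e → x e * (μ B * ind B e)))  ≡⟨ sumSub-cong (λ B → trans (sumE-cong (λ e → reorder (x e) (μ B) (ind B e)))
                                                                                   (sumE-* (μ B) (λ e → ind B e * x e))) ⟩
      sumSub (λ B → μ B * ℓ x B)                         ∎
      where
      reorder : ∀ x m i → x * (m * i) ≡ m * (i * x)
      reorder = solve 3 (λ x m i → x :* (m :* i) := m :* (i :* x)) refl

    expOverlap≡energy : ∀ μ → expOverlap M μ ≡ energy (edgeUsage M μ)
    expOverlap≡energy μ = begin
      sumSub (λ B → sumSub (λ B' → μ B * μ B' * fromℕ ∣ B ∩ B' ∣))
        ≡⟨ sumSub-cong (λ B → sumSub-cong (λ B' → weightedOverlap B B')) ⟩
      sumSub (λ B → sumSub (λ B' → sumE (λ e → (μ B * ind B e) * (μ B' * ind B' e))))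
        ≡⟨ sumSub-cong (λ B → sym (sumE-sumSub-comm (λ e B' → (μ B * ind B e) * (μ B' * ind B' e)))) ⟩
      sumSub (λ B → sumE (λ e → sumSub (λ B' → (μ B * ind B e) * (μ B' * ind B' e))))
        ≡⟨ sumSub-cong (λ B → sumE-cong (λ e → sumSub-* (μ B * ind B e) (λ B' → μ B' * ind B' e))) ⟩
      sumSub (λ B → sumE (λ e → (μ B * ind B e) * z e))
        ≡⟨ sym (sumE-sumSub-comm (λ e B → (μ B * ind B e) * z e)) ⟩
      sumE (λ e → sumSub (λ B → (μ B * ind B e) * z e))
        ≡⟨ sumE-cong (λ e → trans (sumSub-cong {n} (λ B → *-comm _ (z e))) (sumSub-* (z e) (λ B → μ B * ind B e))) ⟩
      energy z
        ∎
      where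
      z : Vector n
      z = edgeUsage M μ
      weightedOverlap : ∀ B B' → μ B * μ B' * fromℕ ∣ B ∩ B' ∣ ≡ sumE (λ e → (μ B * ind B e) * (μ B' * ind B' e))
      weightedOverlap B B' = begin
        μ B * μ B' * fromℕ ∣ B ∩ B' ∣                    ≡⟨ cong (μ B * μ B' *_) (∣∩∣≡dot-ind B B') ⟩
        μ B * μ B' * dot (ind B) (ind B')                ≡⟨ sumE-* (μ B * μ B') (λ e → ind B e * ind B' e) ⟨
        sumE (λ e → μ B * μ B' * (ind B e * ind B' e))   ≡⟨ sumE-cong {n} (λ e → *-interchange (μ B) (μ B') (ind B e) (ind B' e)) ⟩
        sumE (λ e → (μ B * ind B e) * (μ B' * ind B' e)) ∎

    Adm⇒1≤ℓ : ∀ {x B} → Adm (BaseFamily M) x → IsBase M B → 1# ≤ ℓ x B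
    Adm⇒1≤ℓ {B = B} (_ , x-adm) B-base = x-adm (ind B) (B , B-base , λ _ → refl)

    -- Being a base is not decidable, so the case split on it happens under a double negation.
    μ≤μ*ℓ : ∀ {μ x} → IsPMF M μ → Adm (BaseFamily M) x → ∀ B → μ B ≤ μ B * ℓ x B
    μ≤μ*ℓ {μ} {x} (0≤μ , μ-off , _) x-adm B = ≤-stable λ ¬goal → excluded-middle λ
      { (inj₁ B-base) → ¬goal (subst (_≤ μ B * ℓ x B) (*-identityʳ (μ B))
                                     (*-monoˡ-≤-nonNeg (0≤μ B) (Adm⇒1≤ℓ x-adm B-base)))
      ; (inj₂ ¬base)  → ¬goal (≤-reflexive (begin
          μ B            ≡⟨ μ-off B ¬base ⟩
          0#             ≡⟨ zeroˡ (ℓ x B) ⟨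
          0# * ℓ x B     ≡⟨ cong (_* ℓ x B) (μ-off B ¬base) ⟨
          μ B * ℓ x B    ∎)) }

    edgeUsage-BL : ∀ {μ} → IsPMF M μ → BL (Adm (BaseFamily M)) (edgeUsage M μ)
    edgeUsage-BL {μ} pmf@(0≤μ , _ , Σμ≡1) =
      (λ e → sumSub-nonNeg (λ B → *-nonneg (0≤μ B) (ind-nonNeg B e))) ,
      λ x x-adm → subst₂ _≤_ Σμ≡1 (sym (dot-edgeUsage μ x)) (sumSub-mono-≤ (μ≤μ*ℓ pmf x-adm))

    -- Moving mass t from μ towards the point mass at B cannot lower the expected overlap.
    MEOOptimal⇒energy≤dot-ind : ∀ {μ B} → MEOOptimal M μ → IsBase M B →
                                energy (edgeUsage M μ) ≤ dot (edgeUsage M μ) (ind B)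
    MEOOptimal⇒energy≤dot-ind {μ} {B} (pmf , μ-min) B-base = energy-first-order z (ind B) λ t 0≤t t≤1 →
      subst₂ _≤_ (expOverlap≡energy μ) (trans (expOverlap≡energy (μₜ t)) (energy-cong (edgeUsage-μₜ t)))
                 (μ-min (μₜ t) (mix-IsPMF 0≤t t≤1 pmf (pointMass-IsPMF B-base)))
      where
      z : Vector n
      z = edgeUsage M μ
      μₜ : Carrier → Subset n → Carrier
      μₜ t = mix t μ (pointMass B)
      edgeUsage-μₜ : ∀ t e → edgeUsage M (μₜ t) e ≡ (1# - t) * z e + t * ind B e
      edgeUsage-μₜ t e = trans (edgeUsage-mix t μ (pointMass B) e)
                               (cong (λ u → (1# - t) * z e + t * u) (edgeUsage-pointMass B e))

    dot≡1⇒slackness : ∀ {μ x} → IsPMF M μ → Adm (BaseFamily M) x → dot (edgeUsage M μ) x ≡ 1# →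
                      ∀ B → IsBase M B → μ B * (1# - ℓ x B) ≡ 0#
    dot≡1⇒slackness {μ} {x} pmf@(_ , _ , Σμ≡1) x-adm z·x≡1 B _ = begin
      μ B * (1# - ℓ x B)   ≡⟨ solve 2 (λ m l → m :* (con (ℤ.+ 1) :- l) := :- (m :* l :- m)) refl (μ B) (ℓ x B) ⟩
      - excess B           ≡⟨ cong -_ (sumSub-nonNeg-zero (λ B → x≤y⇒0≤y-x (μ≤μ*ℓ pmf x-adm B)) Σexcess≡0 B) ⟩
      - 0#                 ≡⟨ -0#≈0# ⟩
      0#                   ∎
      where
      excess : Subset n → Carrier
      excess B = (μ B * ℓ x B) - μ B
      Σexcess≡0 : sumSub excess ≡ 0#
      Σexcess≡0 = begin
        sumSub excess                           ≡⟨ sumSub-− (λ B → μ B * ℓ x B) μ ⟩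
        sumSub (λ B → μ B * ℓ x B) - sumSub μ   ≡⟨ cong₂ _-_ (trans (sym (dot-edgeUsage μ x)) z·x≡1) Σμ≡1 ⟩
        1# - 1#                                 ≡⟨ -‿inverseʳ 1# ⟩
        0#                                      ∎

    slackness⇒dot≡1 : ∀ {μ x} → IsPMF M μ → (∀ B → IsBase M B → μ B * (1# - ℓ x B) ≡ 0#) →
                      dot (edgeUsage M μ) x ≡ 1#
    slackness⇒dot≡1 {μ} {x} (_ , μ-off , Σμ≡1) slack = trans (dot-edgeUsage μ x) (trans (sumSub-cong μℓ≡μ) Σμ≡1)
      where
      μℓ≡μ : ∀ B → μ B * ℓ x B ≡ μ B
      μℓ≡μ B = ≡-stable λ ¬goal → excluded-middle λ
        { (inj₁ B-base) → ¬goal (begin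
            μ B * ℓ x B                   ≡⟨ solve 2 (λ m l → m :* l := m :- m :* (con (ℤ.+ 1) :- l)) refl (μ B) (ℓ x B) ⟩
            μ B - (μ B * (1# - ℓ x B))    ≡⟨ cong (λ s → μ B - s) (slack B B-base) ⟩
            μ B - 0#                      ≡⟨ cong (μ B +_) -0#≈0# ⟩
            μ B + 0#                      ≡⟨ +-identityʳ (μ B) ⟩
            μ B                           ∎)
        ; (inj₂ ¬base)  → ¬goal (begin
            μ B * ℓ x B    ≡⟨ cong (_* ℓ x B) (μ-off B ¬base) ⟩
            0# * ℓ x B     ≡⟨ zeroˡ (ℓ x B) ⟩
            0#             ≡⟨ μ-off B ¬base ⟨
            μ B            ∎) }

    energy-edgeUsage≢0 : ∀ {μ x} → IsPMF M μ → Adm (BaseFamily M) x → ¬ (energy (edgeUsage M μ) ≡ 0#)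
    energy-edgeUsage≢0 {μ} {x} pmf x-adm Ez≡0 = 1≰0 (subst (1# ≤_) z·x≡0 (proj₂ (edgeUsage-BL pmf) x x-adm))
      where
      z : Vector n
      z = edgeUsage M μ
      z·x≡0 : dot z x ≡ 0#
      z·x≡0 = trans (sumE-cong (λ e → trans (cong (_* x e) (energy-zero z Ez≡0 e)) (zeroˡ (x e)))) (sumE-0 {n})

    MEOOptimal⇒scaled-Adm : ∀ {μ c} → MEOOptimal M μ → 0# ≤ c → c * energy (edgeUsage M μ) ≡ 1# →
                            Adm (BaseFamily M) (λ e → c * edgeUsage M μ e)
    MEOOptimal⇒scaled-Adm {μ} {c} μ-opt@((0≤μ , _) , _) 0≤c c*Ez≡1 =
      (λ e → *-nonneg 0≤c (sumSub-nonNeg (λ B → *-nonneg (0≤μ B) (ind-nonNeg B e)))) ,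
      λ { γ (B , B-base , γ≗ind) → subst (1# ≤_) (sym (γ·cz≡c*z·ind {γ} {B} γ≗ind))
            (subst (_≤ c * dot z (ind B)) c*Ez≡1 (*-monoˡ-≤-nonNeg 0≤c (MEOOptimal⇒energy≤dot-ind μ-opt B-base))) }
      where
      z : Vector n
      z = edgeUsage M μ
      γ·cz≡c*z·ind : ∀ {γ B} → (∀ e → γ e ≡ ind B e) → dot γ (λ e → c * z e) ≡ c * dot z (ind B)
      γ·cz≡c*z·ind {γ} {B} γ≗ind = begin
        dot γ (λ e → c * z e)       ≡⟨ dot-congˡ _ γ≗ind ⟩
        dot (ind B) (λ e → c * z e) ≡⟨ dot-scaleʳ c (ind B) z ⟩
        c * dot (ind B) z           ≡⟨ cong (c *_) (dot-comm (ind B) z) ⟩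
        c * dot z (ind B)           ∎

    MEOOptimal⇒IsMEO : ∀ {μ v} → MEOOptimal M μ → expOverlap M μ ≡ v → IsMEO M v
    MEOOptimal⇒IsMEO {μ} (pmf , μ-min) μ≡v = (μ , pmf , μ≡v) , λ μ' pmf' → subst (_≤ _) μ≡v (μ-min μ' pmf')

  module _ {n : ℕ} (M : Matroid n) {B̃ : Family n} (dual : IsFulkersonDual M B̃) where

    Optimal : Vector n → Vector n → (Subset n → Carrier) → Set
    Optimal ρ η μ = Mod2Optimal (BaseFamily M) ρ × Mod2Optimal B̃ η × MEOOptimal M μ

    Conditions : Vector n → Vector n → (Subset n → Carrier) → Set
    Conditions ρ η μ = (Adm (BaseFamily M) ρ × (∀ e → η e ≡ edgeUsage M μ e))
                     × (∃[ c ] (0# < c × (∀ e → ρ e ≡ c * η e)))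
                     × (∀ B → IsBase M B → μ B * (1# - ℓ ρ B) ≡ 0#)

    -- Weak duality gives ⟨η, ρ'⟩ ≥ 1 on Adm ℬ and ⟨η', ρ⟩ ≥ 1 on BL (Adm ℬ); when ρ = c η and
    -- ⟨η, ρ⟩ = 1, Cauchy–Schwarz turns these into lower bounds c and 1/c attained by ρ and η.
    module Certificate {ρ η μ c} (pmf : IsPMF M μ) (ρ-adm : Adm (BaseFamily M) ρ)
                       (η≗z : ∀ e → η e ≡ edgeUsage M μ e) (0≤c : 0# ≤ c)
                       (ρ≡cη : ∀ e → ρ e ≡ c * η e) (η·ρ≡1 : dot η ρ ≡ 1#) where

      η-BL : BL (Adm (BaseFamily M)) η
      η-BL = (λ e → subst (0# ≤_) (sym (η≗z e)) (proj₁ z-BL e)) ,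
             λ x x-adm → subst (1# ≤_) (sym (dot-congˡ x η≗z)) (proj₂ z-BL x x-adm)
        where
        z-BL : BL (Adm (BaseFamily M)) (edgeUsage M μ)
        z-BL = edgeUsage-BL M pmf

      ρ-certificate : energy ρ ≡ c × (∀ ρ' → Adm (BaseFamily M) ρ' → c ≤ energy ρ')
      ρ-certificate = energy-certificate 0≤c ρ≡cη η·ρ≡1 (proj₂ η-BL)

      energy-ρ : energy ρ ≡ c
      energy-ρ = proj₁ ρ-certificate

      ρ-optimal : Mod2Optimal (BaseFamily M) ρ
      ρ-optimal = ρ-adm , λ ρ' ρ'-adm → subst (_≤ energy ρ') (sym energy-ρ) (proj₂ ρ-certificate ρ' ρ'-adm)

      module _ {d} (c*d≡1 : c * d ≡ 1#) where

        η≡dρ : ∀ e → η e ≡ d * ρ e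
        η≡dρ e = sym (begin
          d * ρ e          ≡⟨ cong (d *_) (ρ≡cη e) ⟩
          d * (c * η e)    ≡⟨ solve 3 (λ d c x → d :* (c :* x) := (c :* d) :* x) refl d c (η e) ⟩
          (c * d) * η e    ≡⟨ cong (_* η e) c*d≡1 ⟩
          1# * η e         ≡⟨ *-identityˡ (η e) ⟩
          η e              ∎)

        η-certificate : energy η ≡ d × (∀ η' → BL (Adm (BaseFamily M)) η' → d ≤ energy η')
        η-certificate = energy-certificate (inverse-nonNeg 0≤c c*d≡1) η≡dρ (trans (dot-comm ρ η) η·ρ≡1)
          (λ η' η'-BL → subst (1# ≤_) (dot-comm η' ρ) (proj₂ η'-BL ρ ρ-adm))

        energy-η : energy η ≡ d
        energy-η = proj₁ η-certificate

        η-optimal : Mod2Optimal B̃ η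
        η-optimal = proj₂ (proj₂ dual) η η-BL ,
          λ η' η'-adm → subst (_≤ energy η') (sym energy-η) (proj₂ η-certificate η' (proj₁ (proj₂ dual) η' η'-adm))

        expOverlap-μ : expOverlap M μ ≡ d
        expOverlap-μ = trans (expOverlap≡energy M μ) (trans (energy-cong (sym ∘ η≗z)) energy-η)

        μ-optimal : MEOOptimal M μ
        μ-optimal = pmf , λ μ' pmf' → subst₂ _≤_ (sym expOverlap-μ) (sym (expOverlap≡energy M μ'))
          (proj₂ η-certificate (edgeUsage M μ') (edgeUsage-BL M pmf'))

    optimal⇒conditions : ∀ {ρ η μ} → Optimal ρ η μ → Conditions ρ η μ
    optimal⇒conditions {ρ} {η} {μ} (ρ-opt , η-opt , μ-opt@(pmf , _)) =
      (proj₁ ρ-opt , η≗z) , (c , (0≤c , 0≢c) , ρ≡cη) , dot≡1⇒slackness M pmf (proj₁ ρ-opt) z·ρ≡1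
      where
      z : Vector n
      z = edgeUsage M μ
      Ez≢0 : ¬ (energy z ≡ 0#)
      Ez≢0 = energy-edgeUsage≢0 M pmf (proj₁ ρ-opt)
      c : Carrier
      c = proj₁ (inverse (energy z) Ez≢0)
      Ez*c≡1 : energy z * c ≡ 1#
      Ez*c≡1 = proj₂ (inverse (energy z) Ez≢0)
      c*Ez≡1 : c * energy z ≡ 1#
      c*Ez≡1 = trans (*-comm c (energy z)) Ez*c≡1
      0≤c : 0# ≤ c
      0≤c = inverse-nonNeg (energy-nonNeg z) Ez*c≡1
      0≢c : ¬ (0# ≡ c)
      0≢c 0≡c = 0≢1 (trans (sym (zeroʳ (energy z))) (trans (cong (energy z *_) 0≡c) Ez*c≡1))
      ρ₀ : Vector n
      ρ₀ e = c * z e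
      z·ρ₀≡1 : dot z ρ₀ ≡ 1#
      z·ρ₀≡1 = trans (dot-scaleʳ c z z) c*Ez≡1
      open Certificate pmf (MEOOptimal⇒scaled-Adm M μ-opt 0≤c c*Ez≡1) (λ _ → refl) 0≤c (λ _ → refl) z·ρ₀≡1
      ρ≗ρ₀ : ∀ e → ρ e ≡ ρ₀ e
      ρ≗ρ₀ = Mod2Optimal-unique (BaseFamily M) ρ-opt ρ-optimal
      η≗z : ∀ e → η e ≡ z e
      η≗z = Mod2Optimal-unique B̃ η-opt (η-optimal c*Ez≡1)
      ρ≡cη : ∀ e → ρ e ≡ c * η e
      ρ≡cη e = trans (ρ≗ρ₀ e) (cong (c *_) (sym (η≗z e)))
      z·ρ≡1 : dot z ρ ≡ 1#
      z·ρ≡1 = trans (dot-congʳ z ρ≗ρ₀) z·ρ₀≡1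

    conditions⇒optimal : ∀ {ρ η μ} → IsPMF M μ → Conditions ρ η μ → Optimal ρ η μ
    conditions⇒optimal {ρ} pmf ((ρ-adm , η≗z) , (c , (0≤c , 0≢c) , ρ≡cη) , slack) =
      ρ-optimal , η-optimal c*c⁻¹≡1 , μ-optimal c*c⁻¹≡1
      where
      open Certificate pmf ρ-adm η≗z 0≤c ρ≡cη (trans (dot-congˡ ρ η≗z) (slackness⇒dot≡1 M pmf slack))
      c*c⁻¹≡1 : c * proj₁ (inverse c (0≢c ∘ sym)) ≡ 1#
      c*c⁻¹≡1 = proj₂ (inverse c (0≢c ∘ sym))

    optimal⇒values : ∀ {ρ η μ} → Optimal ρ η μ → ∀ c → 0# < c → (∀ e → ρ e ≡ c * η e) →
                     IsMod2 (BaseFamily M) c × (∀ c⁻¹ → c * c⁻¹ ≡ 1# → IsMEO M c⁻¹ × IsMod2 B̃ c⁻¹)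
    optimal⇒values {ρ} {η} {μ} opt@(_ , _ , μ-opt@(pmf , _)) c (0≤c , _) ρ≡cη =
      Mod2Optimal⇒IsMod2 ρ-optimal energy-ρ ,
      λ c⁻¹ c*c⁻¹≡1 → MEOOptimal⇒IsMEO M μ-opt (expOverlap-μ c*c⁻¹≡1) ,
                      Mod2Optimal⇒IsMod2 (η-optimal c*c⁻¹≡1) (energy-η c*c⁻¹≡1)
      where
      conditions : Conditions ρ η μ
      conditions = optimal⇒conditions opt
      η≗z : ∀ e → η e ≡ edgeUsage M μ e
      η≗z = proj₂ (proj₁ conditions)
      open Certificate pmf (proj₁ (proj₁ conditions)) η≗z 0≤c ρ≡cη
                       (trans (dot-congˡ ρ η≗z) (slackness⇒dot≡1 M pmf (proj₂ (proj₂ conditions))))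

theorem3p2 : (ℝ : CompleteOrderedField) → let open Real ℝ in
    {n : ℕ} (M : Matroid n) → Loopless M → PositiveRank M →
    (B̃ : Family n) → IsFulkersonDual M B̃ →
    (ρ η : Vector n) → NonNeg ρ → NonNeg η →
    (μ : Subset n → Carrier) → IsPMF M μ →
    ((Mod2Optimal (BaseFamily M) ρ × Mod2Optimal B̃ η × MEOOptimal M μ)
      ⇔ ((Adm (BaseFamily M) ρ × (∀ e → η e ≡ edgeUsage M μ e))
         × (∃[ c ] (0# < c × (∀ e → ρ e ≡ c * η e)))
         × (∀ B → IsBase M B → μ B * (1# - ℓ ρ B) ≡ 0#)))
    × ((Mod2Optimal (BaseFamily M) ρ × Mod2Optimal B̃ η × MEOOptimal M μ) →
       ∀ c → 0# < c → (∀ e → ρ e ≡ c * η e) →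
       IsMod2 (BaseFamily M) c
       × (∀ c⁻¹ → c * c⁻¹ ≡ 1# → IsMEO M c⁻¹ × IsMod2 B̃ c⁻¹))
theorem3p2 ℝ M _ _ B̃ dual ρ η _ _ μ pmf =
  mk⇔ (optimal⇒conditions ℝ M dual) (conditions⇒optimal ℝ M dual pmf) , optimal⇒values ℝ M dual
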